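{- Let $q$ be a primitive integral isotropic ternary quadratic form with $\Delta=\Delta(q)>0$, let $(M_k,D_k)_{k\le K}$ be an admissible family for $q$, fix $k$ such that $\mathcal{C}_k$ is nonempty, and put $M=M_k$. Then the set of all primes may be partitioned into sets $\mathcal{P}_0,\mathcal{P}_1,\mathcal{P}_2$ such that: if $p\nmid\Delta$ then $p\in\mathcal{P}_0$; if $p\in\mathcal{P}_0$ then for $\mathbf{u}\in\mathbb{Z}^2$, $p\mid M\mathbf{u}^2$ if and only if $p\mid\mathbf{u}$; if $p\in\mathcal{P}_n$ with $n\in\{1,2\}$ then there are distinct lattices $\Lambda_i(p)\subseteq\mathbb{Z}^2$ ($1\le i\le n$) of determinant $p$ such that for $\mathbf{u}\in\mathbb{Z}^2$, $p\mid M\mathbf{u}^2$ if and only if $\mathbf{u}$ lies in one of the $\Lambda_i(p)$; and if $p\,\|\,\Delta$ then $p\in\mathcal{P}_1$.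
   Context: For $q(\mathbf{x})=\sum_{1\le i\le j\le3}q_{ij}x_ix_j$ (integral, primitive: coefficients with gcd 1, isotropic: nonzero integer zero), $\Delta(q)=\tfrac12\det\begin{pmatrix}2q_{11}&q_{12}&q_{13}\\ q_{12}&2q_{22}&q_{23}\\ q_{13}&q_{23}&2q_{33}\end{pmatrix}$; $J(\mathbf{x})=x_1x_3-x_2^2$. An admissible family: nonsingular integer $3\times3$ matrices $M_1,\dots,M_K$, positive integers $D_1,\dots,D_K$, with $K\le\tau(\Delta)$, each $\det M_k$ a positive divisor of $\Delta$, every primitive integer zero of $q$ in $M_k(\mathbb{Z}^3)$ for exactly one $k$, $q(M_k\mathbf{x})=D_kJ(\mathbf{x})$ identically, and $\Delta\det(M_k)^2=D_k^3$. $\mathcal{C}_k$ is the set of primitive (gcd of entries 1) $\mathbf{x}\in\mathbb{Z}^3\cap M_k(\mathbb{Z}^3)$ with $q(\mathbf{x})=0$. For $\mathbf{u}=(u_1,u_2)$, $M\mathbf{u}^2=M(u_1^2,u_1u_2,u_2^2)^T$; $p\mid\mathbf{v}$ for a vector means $p$ divides every entry. The determinant of a lattice is its covolume. -}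

module Defs where

open import Data.Nat as ℕ using (ℕ; suc)
open import Data.Nat.Divisibility as ℕD using (_∣?_)
open import Data.Nat.Primality using (Prime)
open import Data.Integer using (ℤ; +_; _+_; _-_; _*_; _<_; ∣_∣)
open import Data.Integer.Divisibility using (_∣_)
open import Data.Fin using (Fin; zero; suc)
open import Data.List using (length; filter; map; upTo)
open import Data.Product using (Σ; ∃; _×_)
open import Relation.Binary.PropositionalEquality using (_≡_; _≢_)
open import Relation.Nullary using (¬_)
open import Function.Bundles using (_⇔_)

Vec3 : Set
Vec3 = Fin 3 → ℤ

Vec2 : Set
Vec2 = Fin 2 → ℤ

_≈₃_ : Vec3 → Vec3 → Set
u ≈₃ v = (i : Fin 3) → u i ≡ v i

_≈₂_ : Vec2 → Vec2 → Set
u ≈₂ v = (i : Fin 2) → u i ≡ v i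

i1 i2 i3 : Fin 3
i1 = zero
i2 = suc zero
i3 = suc (suc zero)

j1 j2 : Fin 2
j1 = zero
j2 = suc zero

Mat3 : Set
Mat3 = Fin 3 → Fin 3 → ℤ

_·₃_ : Mat3 → Vec3 → Vec3
(M ·₃ x) i = M i i1 * x i1 + M i i2 * x i2 + M i i3 * x i3

det3 : Mat3 → ℤ
det3 M = M i1 i1 * (M i2 i2 * M i3 i3 - M i2 i3 * M i3 i2)
       - M i1 i2 * (M i2 i1 * M i3 i3 - M i2 i3 * M i3 i1)
       + M i1 i3 * (M i2 i1 * M i3 i2 - M i2 i2 * M i3 i1)

InImage : Mat3 → Vec3 → Set
InImage M x = ∃ λ (y : Vec3) → (M ·₃ y) ≈₃ x

PrimitiveVec3 : Vec3 → Set
PrimitiveVec3 x = (d : ℕ) → ((i : Fin 3) → (+ d) ∣ x i) → d ≡ 1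

record QF : Set where
  constructor qf
  field
    q11 q12 q13 q22 q23 q33 : ℤ
open QF public

eval : QF → Vec3 → ℤ
eval q x = q11 q * x i1 * x i1 + q12 q * x i1 * x i2 + q13 q * x i1 * x i3
         + q22 q * x i2 * x i2 + q23 q * x i2 * x i3 + q33 q * x i3 * x i3

gram : QF → Mat3
gram q zero zero = + 2 * q11 q
gram q zero (suc zero) = q12 q
gram q zero (suc (suc zero)) = q13 q
gram q (suc zero) zero = q12 q
gram q (suc zero) (suc zero) = + 2 * q22 q
gram q (suc zero) (suc (suc zero)) = q23 q
gram q (suc (suc zero)) zero = q13 q
gram q (suc (suc zero)) (suc zero) = q23 q
gram q (suc (suc zero)) (suc (suc zero)) = + 2 * q33 q

-- Δ(q) = ½ det(gram q), written out explicitly (see Δ-spec below)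
-- (det(gram q) is always even; explicitly Δ = 4 q11 q22 q33 - q11 q23² - q22 q13² - q33 q12² + q12 q13 q23)
Δ : QF → ℤ
Δ q = + 4 * q11 q * q22 q * q33 q - q11 q * q23 q * q23 q - q22 q * q13 q * q13 q
    - q33 q * q12 q * q12 q + q12 q * q13 q * q23 q

PrimitiveQF : QF → Set
PrimitiveQF q = (d : ℕ) → (+ d) ∣ q11 q → (+ d) ∣ q12 q → (+ d) ∣ q13 q
              → (+ d) ∣ q22 q → (+ d) ∣ q23 q → (+ d) ∣ q33 q → d ≡ 1

Isotropic : QF → Set
Isotropic q = ∃ λ (x : Vec3) → ¬ (x ≈₃ (λ _ → + 0)) × eval q x ≡ + 0

J : Vec3 → ℤ
J x = x i1 * x i3 - x i2 * x i2

-- number of positive divisors of a natural number n (τ(0) = 0 convention irrelevant here)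
τ : ℕ → ℕ
τ n = length (filter (_∣? n) (map suc (upTo n)))

record Admissible (q : QF) (K : ℕ) (M : Fin K → Mat3) (D : Fin K → ℤ) : Set where
  field
    K≤τ       : K ℕ.≤ τ ∣ Δ q ∣
    detPos    : (k : Fin K) → + 0 < det3 (M k)
    det∣Δ     : (k : Fin K) → det3 (M k) ∣ Δ q
    DPos      : (k : Fin K) → + 0 < D k
    covers    : (x : Vec3) → PrimitiveVec3 x → eval q x ≡ + 0 → ∃ λ k → InImage (M k) x
    unique    : (x : Vec3) → PrimitiveVec3 x → eval q x ≡ + 0 →
                (k l : Fin K) → InImage (M k) x → InImage (M l) x → k ≡ l
    transform : (k : Fin K) (x : Vec3) → eval q (M k ·₃ x) ≡ D k * J x
    detRel    : (k : Fin K) → Δ q * (det3 (M k) * det3 (M k)) ≡ D k * D k * D k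

CNonempty : QF → Mat3 → Set
CNonempty q M = ∃ λ (x : Vec3) → PrimitiveVec3 x × InImage M x × eval q x ≡ + 0

-- M u² = M (u1², u1 u2, u2²)ᵀ
sq : Vec2 → Vec3
sq u zero = u j1 * u j1
sq u (suc zero) = u j1 * u j2
sq u (suc (suc zero)) = u j2 * u j2

_∣₃_ : ℕ → Vec3 → Set
p ∣₃ v = (i : Fin 3) → (+ p) ∣ v i

_∣₂_ : ℕ → Vec2 → Set
p ∣₂ v = (i : Fin 2) → (+ p) ∣ v i

-- a full-rank lattice in ℤ², given by a basis matrix B (columns are the basis vectors)
Mat2 : Set
Mat2 = Fin 2 → Fin 2 → ℤ

det2 : Mat2 → ℤ
det2 B = B j1 j1 * B j2 j2 - B j1 j2 * B j2 j1

_·₂_ : Mat2 → Vec2 → Vec2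
(B ·₂ y) i = B i j1 * y j1 + B i j2 * y j2

_∈Λ_ : Vec2 → Mat2 → Set
u ∈Λ B = ∃ λ (y : Vec2) → (B ·₂ y) ≈₂ u

SameLattice : Mat2 → Mat2 → Set
SameLattice B C = (u : Vec2) → (u ∈Λ B) ⇔ (u ∈Λ C)

HasDet : Mat2 → ℕ → Set
HasDet B p = ∣ det2 B ∣ ≡ p

ExactlyDivides : ℕ → ℤ → Set
ExactlyDivides p n = (+ p) ∣ n × ¬ ((+ (p ℕ.* p)) ∣ n)

open import Data.Integer.Tactic.RingSolver using (solve-∀)
Δ-spec-poly : ∀ (a b c d e f : ℤ) →
  + 2 * (+ 4 * a * d * f - a * e * e - d * c * c - f * b * b + b * c * e)
  ≡ (+ 2 * a) * ((+ 2 * d) * (+ 2 * f) - e * e)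
    - b * (b * (+ 2 * f) - e * c)
    + c * (b * e - (+ 2 * d) * c)
Δ-spec-poly = solve-∀

Δ-spec : (q : QF) → + 2 * Δ q ≡ det3 (gram q)
Δ-spec (qf a b c d e f) = Δ-spec-poly a b c d e f

-- Fix a prime p and reduce mod p. Each entry of M u² is a binary quadratic form in u, so
-- p ∣ M u² holds exactly when u ≡ 0 or u lies on the line through a common root Q ∈ ℙ¹(𝔽ₚ)
-- of the three rows of M (written as ∞ or as a slope t); that line is a lattice of
-- determinant p. The primes are sorted by the number n of common roots. A primitive zero in
-- M(ℤ³) makes some entry of M prime to p, so some row is a nonzero form and n ≤ 2. If p ∤ Δ
-- then p ∤ det M, M is invertible mod p and there is no root. If p ∥ Δ, then Δ (det M)² = D³
-- forces p ∥ det M and p ∥ D, and q(M w) = D J(w) gives J(w) ≡ 0 whenever M w ≡ 0. A column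
-- of adj M that is nonzero mod p (one exists since det (adj M) = (det M)²) is such a w, and a
-- vector with J(w) ≡ 0 is a multiple of some u², which produces a root. Two roots Q, Q′ are
-- equal, because the polar form of J at (Q², Q′²) is det(Q, Q′)².
module Submission where

open import Defs
open import Data.Fin using (Fin; zero; suc; toℕ; fromℕ<; cast)
import Data.Fin.Properties as Finₚ
open import Data.Integer using (ℤ; +_; _+_; _-_; _*_; -_; ∣_∣; _<_)
open import Data.Integer.Divisibility using (_∣_)
open import Data.Integer.DivMod using (_%ℕ_; _/ℕ_; n%ℕd<d; a≡a%ℕn+[a/ℕn]*n)
import Data.Integer.Divisibility.Signed as Signed
open Signed using (divides; ∣ᵤ⇒∣; ∣⇒∣ᵤ; ∣m∣n⇒∣m+n; ∣m∣n⇒∣m-n; ∣m⇒∣-m; ∣n⇒∣m*n; ∣m⇒∣m*n; ∣m+n∣m⇒∣n; ∣m+n∣n⇒∣m; ∣-trans)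
import Data.Integer.Properties as ℤₚ
open import Data.Integer.Tactic.RingSolver using (solve-∀)
open import Data.List as List using (List; []; _∷_; length; filter; lookup; allFin)
open import Data.List.Membership.Propositional using (_∈_; _∉_)
open import Data.List.Membership.Propositional.Properties using (∈-map⁺; ∈-allFin; ∈-filter⁺; ∈-filter⁻; ∈-lookup)
import Data.List.Relation.Unary.All as All
open All using (_∷_)
import Data.List.Relation.Unary.All.Properties as All
open import Data.List.Relation.Unary.AllPairs using (_∷_)
open import Data.List.Relation.Unary.Any as Any using (here; there)
open import Data.List.Relation.Unary.Any.Properties using (lookup-index)
open import Data.List.Relation.Unary.Unique.Propositional using (Unique)
import Data.List.Relation.Unary.Unique.Propositional.Properties as Uniqueₚ
open import Data.List.Properties using (filter-none)
open import Data.Nat as ℕ using (ℕ)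
import Data.Nat.Divisibility as ℕ∣
import Data.Nat.Properties as ℕₚ
open import Data.Nat.Coprimality using (Coprime; coprime-Bézout)
open import Data.Nat.GCD using (module Bézout)
open import Data.Nat.Primality using (Prime; euclidsLemma; prime⇒nonZero; prime⇒nonTrivial; prime⇒irreducible)
open import Data.Product using (∃; ∃₂; _×_; _,_; proj₁; proj₂)
open import Data.Sum using (_⊎_; inj₁; inj₂; [_,_]′)
import Data.Sum as Sum
open import Function using (id)
open import Function.Bundles using (_⇔_; mk⇔; Equivalence)
open import Relation.Binary.PropositionalEquality using (_≡_; _≢_; refl; sym; trans; cong; subst; subst₂; module ≡-Reasoning)
open import Relation.Nullary using (¬_; Dec; yes; no; contradiction)

private
  variable
    m n p : ℕ
    a b : ℤ
    u : Vec2
    v w x : Vec3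

lookup-injective : ∀ {A : Set} {xs : List A} → Unique xs → ∀ {i j} → lookup xs i ≡ lookup xs j → i ≡ j
lookup-injective {xs = _ ∷ _} _ {zero} {zero} _ = refl
lookup-injective {xs = _ ∷ _} (x∉xs ∷ _) {zero} {suc j} x≡xⱼ = contradiction x≡xⱼ (All.lookup x∉xs (∈-lookup j))
lookup-injective {xs = _ ∷ _} (x∉xs ∷ _) {suc i} {zero} xᵢ≡x = contradiction (sym xᵢ≡x) (All.lookup x∉xs (∈-lookup i))
lookup-injective {xs = _ ∷ _} (_ ∷ xs-unique) {suc i} {suc j} xᵢ≡xⱼ = cong suc (lookup-injective xs-unique xᵢ≡xⱼ)

all-equal⇒length≡1 : ∀ {A : Set} {xs : List A} {x} → Unique xs → x ∈ xs → (∀ {y z} → y ∈ xs → z ∈ xs → y ≡ z) → length xs ≡ 1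
all-equal⇒length≡1 {xs = _ ∷ []} _ _ _ = refl
all-equal⇒length≡1 {xs = _ ∷ _ ∷ _} ((x≢y ∷ _) ∷ _) _ all-equal = contradiction (all-equal (here refl) (there (here refl))) x≢y

length≡0⇒∉ : ∀ {A : Set} {xs : List A} {x} → length xs ≡ 0 → x ∉ xs
length≡0⇒∉ {xs = []} _ ()

-- Defs uses the unsigned divisibility of the standard library; we work with the signed one,
-- whose explicit quotient is closed under the ring operations, and convert at the very end.
infix 4 _∣ℤ_ _∣ℤ₂_ _∣ℤ₃_

_∣ℤ_ : ℕ → ℤ → Set
m ∣ℤ a = + m Signed.∣ a

_∣ℤ₂_ : ℕ → Vec2 → Set
m ∣ℤ₂ u = ∀ i → m ∣ℤ u i

_∣ℤ₃_ : ℕ → Vec3 → Set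
m ∣ℤ₃ v = ∀ i → m ∣ℤ v i

_∣ℤ?_ : ∀ m a → Dec (m ∣ℤ a)
m ∣ℤ? a = + m Signed.∣? a

∣₂⇔∣ℤ₂ : m ∣₂ u ⇔ m ∣ℤ₂ u
∣₂⇔∣ℤ₂ = mk⇔ (λ h i → ∣ᵤ⇒∣ (h i)) (λ h i → ∣⇒∣ᵤ (h i))

∣₃⇔∣ℤ₃ : m ∣₃ v ⇔ m ∣ℤ₃ v
∣₃⇔∣ℤ₃ = mk⇔ (λ h i → ∣ᵤ⇒∣ (h i)) (λ h i → ∣⇒∣ᵤ (h i))

∣ℤ-refl : m ∣ℤ + m
∣ℤ-refl = divides (+ 1) (sym (ℤₚ.*-identityˡ _))

*-pres-∣ℤ : m ∣ℤ a → n ∣ℤ b → m ℕ.* n ∣ℤ a * b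
*-pres-∣ℤ {m} {n = n} (divides k refl) (divides l refl) = divides (k * l) (begin
  k * + m * (l * + n)    ≡⟨ shuffle k (+ m) l (+ n) ⟩
  k * l * (+ m * + n)    ≡⟨ cong (k * l *_) (ℤₚ.pos-* m n) ⟨
  k * l * + (m ℕ.* n)    ∎)
  where
  open ≡-Reasoning
  shuffle : ∀ k m l n → k * m * (l * n) ≡ k * l * (m * n)
  shuffle = solve-∀

∣∧<⇒≡0 : m ℕ∣.∣ n → n ℕ.< m → n ≡ 0
∣∧<⇒≡0 {n = ℕ.zero} _ _ = refl
∣∧<⇒≡0 {n = ℕ.suc _} m∣n n<m = contradiction m∣n (ℕ∣.>⇒∤ n<m)

residues-≡ : m ℕ.< p → n ℕ.< p → p ∣ℤ + m - + n → m ≡ n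
residues-≡ {m} {p} {n} m<p n<p p∣m-n =
  ℤₚ.+-injective (ℤₚ.i-j≡0⇒i≡j (+ m) (+ n) (ℤₚ.∣i∣≡0⇒i≡0 (∣∧<⇒≡0 (∣⇒∣ᵤ p∣m-n) ∣m-n∣<p)))
  where
  ∣m-n∣<p : ∣ + m - + n ∣ ℕ.< p
  ∣m-n∣<p = ℕₚ.≤-<-trans
    (subst (ℕ._≤ m ℕ.⊔ n) (cong ∣_∣ (sym (ℤₚ.[+m]-[+n]≡m⊖n m n))) (ℤₚ.∣m⊝n∣≤m⊔n m n))
    (ℕₚ.⊔-lub m<p n<p)

pos-Bézout : ∀ k l m r → 1 ℕ.+ k ℕ.* l ≡ m ℕ.* r → + 1 + + k * + l ≡ + m * + r
pos-Bézout k l m r eq = begin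
  + 1 + + k * + l     ≡⟨ cong (_+_ (+ 1)) (ℤₚ.pos-* k l) ⟨
  + (1 ℕ.+ k ℕ.* l)   ≡⟨ cong +_ eq ⟩
  + (m ℕ.* r)         ≡⟨ ℤₚ.pos-* m r ⟩
  + m * + r           ∎
  where open ≡-Reasoning

module _ (p-prime : Prime p) where

  ∣m*n⇒∣m⊎∣n : p ∣ℤ a * b → p ∣ℤ a ⊎ p ∣ℤ b
  ∣m*n⇒∣m⊎∣n {a} {b} p∣ab =
    Sum.map ∣ᵤ⇒∣ ∣ᵤ⇒∣ (euclidsLemma ∣ a ∣ ∣ b ∣ p-prime (subst (p ℕ∣.∣_) (ℤₚ.abs-* a b) (∣⇒∣ᵤ p∣ab)))

  ∣m*n∧∤m⇒∣n : p ∣ℤ a * b → ¬ p ∣ℤ a → p ∣ℤ b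
  ∣m*n∧∤m⇒∣n p∣ab p∤a = [ (λ p∣a → contradiction p∣a p∤a) , id ]′ (∣m*n⇒∣m⊎∣n p∣ab)

  ∣m*m⇒∣m : p ∣ℤ a * a → p ∣ℤ a
  ∣m*m⇒∣m p∣aa = [ id , id ]′ (∣m*n⇒∣m⊎∣n p∣aa)

  ∤1 : ¬ p ∣ℤ + 1
  ∤1 p∣1 = ℕ.nonTrivial⇒≢1 {{prime⇒nonTrivial p-prime}} (ℕ∣.∣1⇒≡1 (∣⇒∣ᵤ p∣1))

  ∤⇒coprime : ¬ p ℕ∣.∣ n → Coprime p n
  ∤⇒coprime p∤n (d∣p , d∣n) = [ id , (λ { refl → contradiction d∣n p∤n }) ]′ (prime⇒irreducible p-prime d∣p)

  ∃-inverseℕ : ¬ p ℕ∣.∣ n → ∃ λ z → p ∣ℤ z * + n - + 1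
  ∃-inverseℕ {n} p∤n with coprime-Bézout (∤⇒coprime p∤n)
  ... | Bézout.+- x y eq = - + y , divides (- + x) (begin
    - + y * + n - + 1       ≡⟨ neg-step (+ y) (+ n) ⟩
    - (+ 1 + + y * + n)     ≡⟨ cong -_ (pos-Bézout y n x p eq) ⟩
    - (+ x * + p)           ≡⟨ ℤₚ.neg-distribˡ-* (+ x) (+ p) ⟩
    - + x * + p             ∎)
    where
    open ≡-Reasoning
    neg-step : ∀ y n → - y * n - + 1 ≡ - (+ 1 + y * n)
    neg-step = solve-∀
  ... | Bézout.-+ x y eq = + y , divides (+ x) (begin
    + y * + n - + 1         ≡⟨ cong (_- + 1) (pos-Bézout x p y n eq) ⟨
    + 1 + + x * + p - + 1   ≡⟨ cancel (+ x * + p) ⟩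
    + x * + p               ∎)
    where
    open ≡-Reasoning
    cancel : ∀ c → + 1 + c - + 1 ≡ c
    cancel = solve-∀

  ∃-inverse : ¬ p ∣ℤ a → ∃ λ z → p ∣ℤ z * a - + 1
  ∃-inverse {a} p∤a with ∃-inverseℕ (λ p∣∣a∣ → p∤a (∣ᵤ⇒∣ p∣∣a∣)) | ℤₚ.+∣i∣≡i⊎+∣i∣≡-i a
  ... | z , h | inj₁ ∣a∣≡a = z , subst (λ c → p ∣ℤ z * c - + 1) ∣a∣≡a h
  ... | z , h | inj₂ ∣a∣≡-a = - z , subst (λ c → p ∣ℤ c - + 1) (begin
    z * + ∣ a ∣     ≡⟨ cong (z *_) ∣a∣≡-a ⟩
    z * - a         ≡⟨ ℤₚ.neg-distribʳ-* z a ⟨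
    - (z * a)       ≡⟨ ℤₚ.neg-distribˡ-* z a ⟩
    - z * a         ∎) h
    where open ≡-Reasoning

_·_ : Vec3 → Vec3 → ℤ
f · x = f i1 * x i1 + f i2 * x i2 + f i3 * x i3

·-∣ʳ : m ∣ℤ₃ x → (f : Vec3) → m ∣ℤ f · x
·-∣ʳ m∣x f = ∣m∣n⇒∣m+n (∣m∣n⇒∣m+n (∣n⇒∣m*n (f i1) (m∣x i1)) (∣n⇒∣m*n (f i2) (m∣x i2))) (∣n⇒∣m*n (f i3) (m∣x i3))

·-∣ˡ : ∀ {f} → m ∣ℤ₃ f → (x : Vec3) → m ∣ℤ f · x
·-∣ˡ m∣f x = ∣m∣n⇒∣m+n (∣m∣n⇒∣m+n (∣m⇒∣m*n (x i1) (m∣f i1)) (∣m⇒∣m*n (x i2) (m∣f i2))) (∣m⇒∣m*n (x i3) (m∣f i3))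

·₃-+ : ∀ (M : Mat3) v w i → (M ·₃ (λ j → v j + w j)) i ≡ (M ·₃ v) i + (M ·₃ w) i
·₃-+ M v w i = distrib (M i i1) (M i i2) (M i i3) (v i1) (v i2) (v i3) (w i1) (w i2) (w i3)
  where
  distrib : ∀ a b c x y z x′ y′ z′ →
            a * (x + x′) + b * (y + y′) + c * (z + z′) ≡ (a * x + b * y + c * z) + (a * x′ + b * y′ + c * z′)
  distrib = solve-∀

δ : Fin n → Fin n → ℤ
δ zero zero = + 1
δ zero (suc _) = + 0
δ (suc _) zero = + 0
δ (suc s) (suc i) = δ s i

·₃-δ : ∀ (N : Mat3) r s → (N ·₃ δ s) r ≡ N r s
·₃-δ N r zero = column₁ (N r i1) (N r i2) (N r i3)
  where
  column₁ : ∀ a b c → a * + 1 + b * + 0 + c * + 0 ≡ a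
  column₁ = solve-∀
·₃-δ N r (suc zero) = column₂ (N r i1) (N r i2) (N r i3)
  where
  column₂ : ∀ a b c → a * + 0 + b * + 1 + c * + 0 ≡ b
  column₂ = solve-∀
·₃-δ N r (suc (suc zero)) = column₃ (N r i1) (N r i2) (N r i3)
  where
  column₃ : ∀ a b c → a * + 0 + b * + 0 + c * + 1 ≡ c
  column₃ = solve-∀

next : Fin 3 → Fin 3
next zero = i2
next (suc zero) = i3
next (suc (suc zero)) = i1

-- The cofactor of (s , r); taking the indices cyclically builds in the signs.
adj : Mat3 → Mat3
adj M r s = M (next s) (next r) * M (next (next s)) (next (next r))
          - M (next s) (next (next r)) * M (next (next s)) (next r)

adj-·₃ : ∀ M v i → (adj M ·₃ (M ·₃ v)) i ≡ det3 M * v i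
adj-·₃ M v zero = row₁ (M i1 i1) (M i1 i2) (M i1 i3) (M i2 i1) (M i2 i2) (M i2 i3) (M i3 i1) (M i3 i2) (M i3 i3) (v i1) (v i2) (v i3)
  where
  row₁ : ∀ a b c d e f g h k x y z →
         (e * k - f * h) * (a * x + b * y + c * z) + (h * c - k * b) * (d * x + e * y + f * z)
           + (b * f - c * e) * (g * x + h * y + k * z)
         ≡ (a * (e * k - f * h) - b * (d * k - f * g) + c * (d * h - e * g)) * x
  row₁ = solve-∀
adj-·₃ M v (suc zero) = row₂ (M i1 i1) (M i1 i2) (M i1 i3) (M i2 i1) (M i2 i2) (M i2 i3) (M i3 i1) (M i3 i2) (M i3 i3) (v i1) (v i2) (v i3)
  where
  row₂ : ∀ a b c d e f g h k x y z →
         (f * g - d * k) * (a * x + b * y + c * z) + (k * a - g * c) * (d * x + e * y + f * z)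
           + (c * d - a * f) * (g * x + h * y + k * z)
         ≡ (a * (e * k - f * h) - b * (d * k - f * g) + c * (d * h - e * g)) * y
  row₂ = solve-∀
adj-·₃ M v (suc (suc zero)) = row₃ (M i1 i1) (M i1 i2) (M i1 i3) (M i2 i1) (M i2 i2) (M i2 i3) (M i3 i1) (M i3 i2) (M i3 i3) (v i1) (v i2) (v i3)
  where
  row₃ : ∀ a b c d e f g h k x y z →
         (d * h - e * g) * (a * x + b * y + c * z) + (g * b - h * a) * (d * x + e * y + f * z)
           + (a * e - b * d) * (g * x + h * y + k * z)
         ≡ (a * (e * k - f * h) - b * (d * k - f * g) + c * (d * h - e * g)) * z
  row₃ = solve-∀

·₃-adj : ∀ M v i → (M ·₃ (adj M ·₃ v)) i ≡ det3 M * v i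
·₃-adj M v zero = row₁ (M i1 i1) (M i1 i2) (M i1 i3) (M i2 i1) (M i2 i2) (M i2 i3) (M i3 i1) (M i3 i2) (M i3 i3) (v i1) (v i2) (v i3)
  where
  row₁ : ∀ a b c d e f g h k x y z →
         let w₁ = (e * k - f * h) * x + (h * c - k * b) * y + (b * f - c * e) * z
             w₂ = (f * g - d * k) * x + (k * a - g * c) * y + (c * d - a * f) * z
             w₃ = (d * h - e * g) * x + (g * b - h * a) * y + (a * e - b * d) * z
         in a * w₁ + b * w₂ + c * w₃ ≡ (a * (e * k - f * h) - b * (d * k - f * g) + c * (d * h - e * g)) * x
  row₁ = solve-∀
·₃-adj M v (suc zero) = row₂ (M i1 i1) (M i1 i2) (M i1 i3) (M i2 i1) (M i2 i2) (M i2 i3) (M i3 i1) (M i3 i2) (M i3 i3) (v i1) (v i2) (v i3)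
  where
  row₂ : ∀ a b c d e f g h k x y z →
         let w₁ = (e * k - f * h) * x + (h * c - k * b) * y + (b * f - c * e) * z
             w₂ = (f * g - d * k) * x + (k * a - g * c) * y + (c * d - a * f) * z
             w₃ = (d * h - e * g) * x + (g * b - h * a) * y + (a * e - b * d) * z
         in d * w₁ + e * w₂ + f * w₃ ≡ (a * (e * k - f * h) - b * (d * k - f * g) + c * (d * h - e * g)) * y
  row₂ = solve-∀
·₃-adj M v (suc (suc zero)) = row₃ (M i1 i1) (M i1 i2) (M i1 i3) (M i2 i1) (M i2 i2) (M i2 i3) (M i3 i1) (M i3 i2) (M i3 i3) (v i1) (v i2) (v i3)
  where
  row₃ : ∀ a b c d e f g h k x y z →
         let w₁ = (e * k - f * h) * x + (h * c - k * b) * y + (b * f - c * e) * z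
             w₂ = (f * g - d * k) * x + (k * a - g * c) * y + (c * d - a * f) * z
             w₃ = (d * h - e * g) * x + (g * b - h * a) * y + (a * e - b * d) * z
         in g * w₁ + h * w₂ + k * w₃ ≡ (a * (e * k - f * h) - b * (d * k - f * g) + c * (d * h - e * g)) * z
  row₃ = solve-∀

det3-adj : ∀ M → det3 (adj M) ≡ det3 M * det3 M
det3-adj M = entries (M i1 i1) (M i1 i2) (M i1 i3) (M i2 i1) (M i2 i2) (M i2 i3) (M i3 i1) (M i3 i2) (M i3 i3)
  where
  entries : ∀ a b c d e f g h k →
            let A₁₁ = e * k - f * h ; A₁₂ = h * c - k * b ; A₁₃ = b * f - c * e
                A₂₁ = f * g - d * k ; A₂₂ = k * a - g * c ; A₂₃ = c * d - a * f
                A₃₁ = d * h - e * g ; A₃₂ = g * b - h * a ; A₃₃ = a * e - b * d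
                d₀ = a * (e * k - f * h) - b * (d * k - f * g) + c * (d * h - e * g)
            in A₁₁ * (A₂₂ * A₃₃ - A₂₃ * A₃₂) - A₁₂ * (A₂₁ * A₃₃ - A₂₃ * A₃₁) + A₁₃ * (A₂₁ * A₃₂ - A₂₂ * A₃₁)
               ≡ d₀ * d₀
  entries = solve-∀

det3-∣ : ∀ {N : Mat3} → (∀ r s → m ∣ℤ N r s) → m ℕ.* (m ℕ.* m) ∣ℤ det3 N
det3-∣ {m} {N} m∣N = ∣m∣n⇒∣m+n (∣m∣n⇒∣m-n (term i1 i2 i3) (term i2 i1 i3)) (term i3 i1 i2)
  where
  term : ∀ s t r → m ℕ.* (m ℕ.* m) ∣ℤ N i1 s * (N i2 t * N i3 r - N i2 r * N i3 t)
  term s t r = *-pres-∣ℤ (m∣N i1 s) (∣m∣n⇒∣m-n (*-pres-∣ℤ (m∣N i2 t) (m∣N i3 r)) (*-pres-∣ℤ (m∣N i2 r) (m∣N i3 t)))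

∃-entry-∤ : ∀ {N : Mat3} → ¬ (∀ r s → m ∣ℤ N r s) → ∃₂ λ r s → ¬ m ∣ℤ N r s
∃-entry-∤ {m} {N} ¬m∣N with Finₚ.¬∀⟶∃¬ 3 _ (λ r → Finₚ.all? (λ s → m ∣ℤ? N r s)) ¬m∣N
... | r , ¬m∣row = r , Finₚ.¬∀⟶∃¬ 3 _ (λ s → m ∣ℤ? N r s) ¬m∣row

eval-∣ : ∀ q → m ∣ℤ₃ x → m ℕ.* m ∣ℤ eval q x
eval-∣ {m} {x} q m∣x =
  ∣m∣n⇒∣m+n (∣m∣n⇒∣m+n (∣m∣n⇒∣m+n (∣m∣n⇒∣m+n (∣m∣n⇒∣m+n
    (term (q11 q) i1 i1) (term (q12 q) i1 i2)) (term (q13 q) i1 i3))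
    (term (q22 q) i2 i2)) (term (q23 q) i2 i3)) (term (q33 q) i3 i3)
  where
  term : ∀ c i j → m ℕ.* m ∣ℤ c * x i * x j
  term c i j = *-pres-∣ℤ (∣n⇒∣m*n c (m∣x i)) (m∣x j)

-- The projective line over 𝔽ₚ

data Point (p : ℕ) : Set where
  ∞ : Point p
  slope : Fin p → Point p

points : (p : ℕ) → List (Point p)
points p = ∞ ∷ List.map slope (allFin p)

∈-points : (Q : Point p) → Q ∈ points p
∈-points ∞ = here refl
∈-points (slope t) = there (∈-map⁺ slope (∈-allFin t))

points-unique : Unique (points p)
points-unique {p} = All.map⁺ (All.universal (λ _ ()) (allFin p)) ∷ Uniqueₚ.map⁺ slope-injective (Uniqueₚ.allFin⁺ p)
  where
  slope-injective : ∀ {s t : Fin p} → slope s ≡ slope t → s ≡ t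
  slope-injective refl = refl

slope-≢ : ∀ {s t : Fin p} → slope s ≢ slope t → s ≢ t
slope-≢ slope-s≢slope-t s≡t = slope-s≢slope-t (cong slope s≡t)

distinct-residues : ∀ {s t : Fin p} → s ≢ t → ¬ p ∣ℤ + toℕ s - + toℕ t
distinct-residues {s = s} {t} s≢t p∣s-t = s≢t (Finₚ.toℕ-injective (residues-≡ (Finₚ.toℕ<n s) (Finₚ.toℕ<n t) p∣s-t))

vec2 : ℤ → ℤ → Vec2
vec2 a b zero = a
vec2 a b (suc zero) = b

rep : Point p → Vec2
rep ∞ = vec2 (+ 0) (+ 1)
rep (slope t) = vec2 (+ 1) (+ toℕ t)

coord : Point p → Vec2 → ℤ
coord ∞ u = u j2
coord (slope _) u = u j1

cross : Vec2 → Vec2 → ℤ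
cross r u = r j1 * u j2 - r j2 * u j1

OnLine : Point p → Vec2 → Set
OnLine {p} Q u = p ∣ℤ cross (rep Q) u

OnLine-rep : (Q : Point p) → OnLine Q (rep Q)
OnLine-rep Q = divides (+ 0) (alternating (rep Q j1) (rep Q j2))
  where
  alternating : ∀ a b → a * b - b * a ≡ + 0
  alternating = solve-∀

∣ℤ₂⇒OnLine : p ∣ℤ₂ u → (Q : Point p) → OnLine Q u
∣ℤ₂⇒OnLine p∣u Q = ∣m∣n⇒∣m-n (∣n⇒∣m*n (rep Q j1) (p∣u j2)) (∣n⇒∣m*n (rep Q j2) (p∣u j1))

OnLine⇒·sq : (f : Vec3) (Q : Point p) → OnLine Q u → p ∣ℤ f · sq u - coord Q u * coord Q u * (f · sq (rep Q))
OnLine⇒·sq {u = u} f ∞ on = subst (_ ∣ℤ_) (sym (at-∞ (f i1) (f i2) (f i3) (u j1) (u j2))) (∣n⇒∣m*n (- (f i1 * u j1 + f i2 * u j2)) on)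
  where
  at-∞ : ∀ a b c x y →
         a * (x * x) + b * (x * y) + c * (y * y) - y * y * (a * (+ 0 * + 0) + b * (+ 0 * + 1) + c * (+ 1 * + 1))
         ≡ - (a * x + b * y) * (+ 0 * y - + 1 * x)
  at-∞ = solve-∀
OnLine⇒·sq {u = u} f (slope t) on = subst (_ ∣ℤ_) (sym (at-slope (f i1) (f i2) (f i3) (u j1) (u j2) (+ toℕ t))) (∣n⇒∣m*n (f i2 * u j1 + f i3 * (u j2 + + toℕ t * u j1)) on)
  where
  at-slope : ∀ a b c x y t →
             a * (x * x) + b * (x * y) + c * (y * y) - x * x * (a * (+ 1 * + 1) + b * (+ 1 * t) + c * (t * t))
             ≡ (b * x + c * (y + t * x)) * (+ 1 * y - t * x)
  at-slope = solve-∀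

OnLine⇒root : ∀ (f : Vec3) {Q : Point p} → p ∣ℤ f · sq (rep Q) → OnLine Q u → p ∣ℤ f · sq u
OnLine⇒root {u = u} f {Q} p∣root on =
  ∣m+n∣n⇒∣m (OnLine⇒·sq f Q on) (∣m⇒∣-m (∣n⇒∣m*n (coord Q u * coord Q u) p∣root))

module _ (p-prime : Prime p) where

  private instance
    p≢0 : ℕ.NonZero p
    p≢0 = prime⇒nonZero p-prime

  OnLine-rep⇒≡ : (Q Q′ : Point p) → OnLine Q (rep Q′) → Q ≡ Q′
  OnLine-rep⇒≡ ∞ ∞ _ = refl
  OnLine-rep⇒≡ ∞ (slope s) p∣-1 = contradiction (∣m⇒∣-m p∣-1) (∤1 p-prime)
  OnLine-rep⇒≡ (slope t) ∞ p∣1 = contradiction (subst (p ∣ℤ_) (at-∞ (+ toℕ t)) p∣1) (∤1 p-prime)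
    where
    at-∞ : ∀ t → + 1 * + 1 - t * + 0 ≡ + 1
    at-∞ = solve-∀
  OnLine-rep⇒≡ (slope t) (slope s) p∣s-t =
    cong slope (sym (Finₚ.toℕ-injective (residues-≡ (Finₚ.toℕ<n s) (Finₚ.toℕ<n t) (subst (p ∣ℤ_) (difference (+ toℕ s) (+ toℕ t)) p∣s-t))))
    where
    difference : ∀ s t → + 1 * s - t * + 1 ≡ s - t
    difference = solve-∀

  root⇐OnLine : ∀ (f : Vec3) {Q : Point p} → OnLine Q u → ¬ p ∣ℤ coord Q u → p ∣ℤ f · sq u → p ∣ℤ f · sq (rep Q)
  root⇐OnLine {u = u} f {Q} on p∤c p∣fu =
    ∣m*n∧∤m⇒∣n p-prime (subst (p ∣ℤ_) (ℤₚ.neg-involutive _) (∣m⇒∣-m (∣m+n∣m⇒∣n (OnLine⇒·sq f Q on) p∣fu)))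
      (λ p∣c² → p∤c (∣m*m⇒∣m p-prime p∣c²))

  residue : ℤ → Fin p
  residue a = fromℕ< (n%ℕd<d a p)

  residue-∣ : ∀ a → p ∣ℤ a - + toℕ (residue a)
  residue-∣ a = divides (a /ℕ p) (begin
    a - + toℕ (residue a)                      ≡⟨ cong (λ r → a - + r) (Finₚ.toℕ-fromℕ< (n%ℕd<d a p)) ⟩
    a - + (a %ℕ p)                             ≡⟨ cong (_- + (a %ℕ p)) (a≡a%ℕn+[a/ℕn]*n a p) ⟩
    + (a %ℕ p) + (a /ℕ p) * + p - + (a %ℕ p)   ≡⟨ cancel (+ (a %ℕ p)) ((a /ℕ p) * + p) ⟩
    (a /ℕ p) * + p                             ∎)
    where
    open ≡-Reasoning
    cancel : ∀ r s → r + s - r ≡ s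
    cancel = solve-∀

  classify : ∀ u → p ∣ℤ₂ u ⊎ ∃ λ (Q : Point p) → OnLine Q u × ¬ p ∣ℤ coord Q u
  classify u with p ∣ℤ? u j1 | p ∣ℤ? u j2
  ... | yes p∣u₁ | yes p∣u₂ = inj₁ λ { zero → p∣u₁ ; (suc zero) → p∣u₂ }
  ... | yes p∣u₁ | no p∤u₂ = inj₂ (∞ , ∣m∣n⇒∣m-n (∣m⇒∣m*n (u j2) (divides (+ 0) refl)) (∣n⇒∣m*n (+ 1) p∣u₁) , p∤u₂)
  ... | no p∤u₁ | _ = inj₂ (slope (residue (z * u j2)) , on-slope , p∤u₁)
    where
    z : ℤ
    z = proj₁ (∃-inverse p-prime p∤u₁)
    p∣zu₁-1 : p ∣ℤ z * u j1 - + 1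
    p∣zu₁-1 = proj₂ (∃-inverse p-prime p∤u₁)
    -- With t ≡ z u₂ and z u₁ ≡ 1, the residue t is the slope u₂ / u₁.
    on-slope : OnLine (slope (residue (z * u j2))) u
    on-slope = subst (p ∣ℤ_) (sym (cross-slope (u j1) (u j2) z (+ toℕ (residue (z * u j2)))))
      (∣m∣n⇒∣m-n (∣n⇒∣m*n (u j1) (residue-∣ (z * u j2))) (∣n⇒∣m*n (u j2) p∣zu₁-1))
      where
      cross-slope : ∀ x y z t → + 1 * y - t * x ≡ x * (z * y - t) - y * (z * x - + 1)
      cross-slope = solve-∀

-- Common roots of the rows of M u²

RootOf : Vec3 → Point p → Set
RootOf {p} f Q = p ∣ℤ f · sq (rep Q)

IsRoot : Mat3 → Point p → Set
IsRoot {p} M Q = p ∣ℤ₃ M ·₃ sq (rep Q)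

isRoot? : (M : Mat3) (Q : Point p) → Dec (IsRoot M Q)
isRoot? {p} M Q = Finₚ.all? (λ i → p ∣ℤ? (M ·₃ sq (rep Q)) i)

roots : Mat3 → (p : ℕ) → List (Point p)
roots M p = filter (isRoot? M) (points p)

∈-roots⇔ : ∀ M {Q : Point p} → Q ∈ roots M p ⇔ IsRoot M Q
∈-roots⇔ M {Q} = mk⇔ (λ Q∈ → proj₂ (∈-filter⁻ (isRoot? M) Q∈)) (∈-filter⁺ (isRoot? M) (∈-points Q))

roots-unique : ∀ M → Unique (roots M p)
roots-unique M = Uniqueₚ.filter⁺ (isRoot? M) points-unique

sq-∣ : p ∣ℤ₂ u → p ∣ℤ₃ sq u
sq-∣ {u = u} p∣u zero = ∣m⇒∣m*n (u j1) (p∣u j1)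
sq-∣ {u = u} p∣u (suc zero) = ∣m⇒∣m*n (u j2) (p∣u j1)
sq-∣ {u = u} p∣u (suc (suc zero)) = ∣m⇒∣m*n (u j2) (p∣u j2)

module _ (p-prime : Prime p) where

  ·₃sq-∣⇔ : (M : Mat3) (u : Vec2) → p ∣ℤ₃ M ·₃ sq u ⇔ (p ∣ℤ₂ u ⊎ ∃ λ (Q : Point p) → IsRoot M Q × OnLine Q u)
  ·₃sq-∣⇔ M u = mk⇔ to from
    where
    to : p ∣ℤ₃ M ·₃ sq u → p ∣ℤ₂ u ⊎ ∃ λ Q → IsRoot M Q × OnLine Q u
    to p∣Mu with classify p-prime u
    ... | inj₁ p∣u = inj₁ p∣u
    ... | inj₂ (Q , on , p∤c) = inj₂ (Q , (λ i → root⇐OnLine p-prime {u = u} (M i) {Q} on p∤c (p∣Mu i)) , on)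
    from : p ∣ℤ₂ u ⊎ ∃ (λ Q → IsRoot M Q × OnLine Q u) → p ∣ℤ₃ M ·₃ sq u
    from (inj₁ p∣u) i = ·-∣ʳ (sq-∣ {u = u} p∣u) (M i)
    from (inj₂ (Q , root , on)) i = OnLine⇒root {u = u} (M i) {Q} (root i) on

  ∃-root : ∀ M {u} → ¬ p ∣ℤ₂ u → p ∣ℤ₃ M ·₃ sq u → ∃ λ (Q : Point p) → IsRoot M Q
  ∃-root M {u} p∤u p∣Mu² with Equivalence.to (·₃sq-∣⇔ M u) p∣Mu²
  ... | inj₁ p∣u = contradiction p∣u p∤u
  ... | inj₂ (Q , root , _) = Q , root

  ∞-root : (f : Vec3) → RootOf f ∞ → p ∣ℤ f i3
  ∞-root f root = subst (p ∣ℤ_) (value (f i1) (f i2) (f i3)) root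
    where
    value : ∀ a b c → a * (+ 0 * + 0) + b * (+ 0 * + 1) + c * (+ 1 * + 1) ≡ c
    value = solve-∀

  slopes-root : (f : Vec3) {s t : Fin p} → s ≢ t → RootOf f (slope s) → RootOf f (slope t) →
                p ∣ℤ f i2 + f i3 * (+ toℕ s + + toℕ t)
  slopes-root f {s} {t} s≢t root-s root-t =
    ∣m*n∧∤m⇒∣n p-prime (subst (p ∣ℤ_) (difference (f i1) (f i2) (f i3) (+ toℕ s) (+ toℕ t)) (∣m∣n⇒∣m-n root-s root-t))
      (distinct-residues s≢t)
    where
    difference : ∀ a b c s t → (a * (+ 1 * + 1) + b * (+ 1 * s) + c * (s * s)) - (a * (+ 1 * + 1) + b * (+ 1 * t) + c * (t * t))
                               ≡ (s - t) * (b + c * (s + t))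
    difference = solve-∀

  slope-root-∣ : (f : Vec3) {t : Fin p} → RootOf f (slope t) → p ∣ℤ f i2 → p ∣ℤ f i3 → p ∣ℤ₃ f
  slope-root-∣ f {t} root p∣b p∣c zero = subst (p ∣ℤ_) (constant (f i1) (f i2) (f i3) (+ toℕ t))
    (∣m∣n⇒∣m-n (∣m∣n⇒∣m-n root (∣m⇒∣m*n (+ toℕ t) p∣b)) (∣m⇒∣m*n (+ toℕ t * + toℕ t) p∣c))
    where
    constant : ∀ a b c t → a * (+ 1 * + 1) + b * (+ 1 * t) + c * (t * t) - b * t - c * (t * t) ≡ a
    constant = solve-∀
  slope-root-∣ f root p∣b p∣c (suc zero) = p∣b
  slope-root-∣ f root p∣b p∣c (suc (suc zero)) = p∣c

  linear-∣ : ∀ b c x → p ∣ℤ b + c * x → p ∣ℤ c → p ∣ℤ b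
  linear-∣ b c x p∣b+cx p∣c = ∣m+n∣n⇒∣m p∣b+cx (∣m⇒∣m*n x p∣c)

  ∞-slopes : (f : Vec3) {s t : Fin p} → s ≢ t → RootOf f ∞ → RootOf f (slope s) → RootOf f (slope t) → p ∣ℤ₃ f
  ∞-slopes f s≢t root-∞ root-s root-t =
    slope-root-∣ f root-s (linear-∣ (f i2) (f i3) _ (slopes-root f s≢t root-s root-t) p∣c) p∣c
    where
    p∣c : p ∣ℤ f i3
    p∣c = ∞-root f root-∞

  three-roots : (f : Vec3) {Q₁ Q₂ Q₃ : Point p} → Q₁ ≢ Q₂ → Q₁ ≢ Q₃ → Q₂ ≢ Q₃ →
                RootOf f Q₁ → RootOf f Q₂ → RootOf f Q₃ → p ∣ℤ₃ f
  three-roots f {∞} {∞} Q₁≢Q₂ _ _ _ _ _ = contradiction refl Q₁≢Q₂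
  three-roots f {∞} {slope _} {∞} _ Q₁≢Q₃ _ _ _ _ = contradiction refl Q₁≢Q₃
  three-roots f {∞} {slope s} {slope t} _ _ Q₂≢Q₃ root₁ root₂ root₃ = ∞-slopes f (slope-≢ Q₂≢Q₃) root₁ root₂ root₃
  three-roots f {slope _} {∞} {∞} _ _ Q₂≢Q₃ _ _ _ = contradiction refl Q₂≢Q₃
  three-roots f {slope s} {∞} {slope t} _ Q₁≢Q₃ _ root₁ root₂ root₃ = ∞-slopes f (slope-≢ Q₁≢Q₃) root₂ root₁ root₃
  three-roots f {slope s} {slope t} {∞} Q₁≢Q₂ _ _ root₁ root₂ root₃ = ∞-slopes f (slope-≢ Q₁≢Q₂) root₃ root₁ root₂
  three-roots f {slope s} {slope t} {slope r} Q₁≢Q₂ Q₁≢Q₃ Q₂≢Q₃ root₁ root₂ root₃ =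
    slope-root-∣ f root₁ (linear-∣ (f i2) (f i3) _ b+c[s+t] p∣c) p∣c
    where
    b+c[s+t] : p ∣ℤ f i2 + f i3 * (+ toℕ s + + toℕ t)
    b+c[s+t] = slopes-root f (slope-≢ Q₁≢Q₂) root₁ root₂
    b+c[s+r] : p ∣ℤ f i2 + f i3 * (+ toℕ s + + toℕ r)
    b+c[s+r] = slopes-root f (slope-≢ Q₁≢Q₃) root₁ root₃
    difference : ∀ b c s t r → (b + c * (s + t)) - (b + c * (s + r)) ≡ (t - r) * c
    difference = solve-∀
    p∣c : p ∣ℤ f i3
    p∣c = ∣m*n∧∤m⇒∣n p-prime (subst (p ∣ℤ_) (difference (f i2) (f i3) (+ toℕ s) (+ toℕ t) (+ toℕ r)) (∣m∣n⇒∣m-n b+c[s+t] b+c[s+r]))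
      (distinct-residues (slope-≢ Q₂≢Q₃))

  length-roots≤2 : ∀ M {r s} → ¬ p ∣ℤ M r s → length (roots M p) ℕ.≤ 2
  length-roots≤2 M {r} {s} p∤Mrs = at-most-two (roots M p) (roots-unique M) (λ Q∈ → Equivalence.to (∈-roots⇔ M) Q∈ r)
    where
    at-most-two : (L : List (Point p)) → Unique L → (∀ {Q} → Q ∈ L → RootOf (M r) Q) → length L ℕ.≤ 2
    at-most-two [] _ _ = ℕ.z≤n
    at-most-two (_ ∷ []) _ _ = ℕ.s≤s ℕ.z≤n
    at-most-two (_ ∷ _ ∷ []) _ _ = ℕ.s≤s (ℕ.s≤s ℕ.z≤n)
    at-most-two (_ ∷ _ ∷ _ ∷ _) ((Q₁≢Q₂ ∷ Q₁≢Q₃ ∷ _) ∷ (Q₂≢Q₃ ∷ _) ∷ _) root =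
      contradiction (three-roots (M r) Q₁≢Q₂ Q₁≢Q₃ Q₂≢Q₃ (root (here refl)) (root (there (here refl))) (root (there (there (here refl)))) s) p∤Mrs

  ·₃-∣⇒∣ : ∀ M {v} → ¬ p ∣ℤ det3 M → p ∣ℤ₃ M ·₃ v → p ∣ℤ₃ v
  ·₃-∣⇒∣ M {v} p∤d p∣Mv i = ∣m*n∧∤m⇒∣n p-prime (subst (p ∣ℤ_) (adj-·₃ M v i) (·-∣ʳ p∣Mv (adj M i))) p∤d

  no-roots : ∀ M → ¬ p ∣ℤ det3 M → length (roots M p) ≡ 0
  no-roots M p∤d = cong length (filter-none (isRoot? M) (All.universal not-root (points p)))
    where
    not-root : (Q : Point p) → ¬ IsRoot M Q
    not-root ∞ root = ∤1 p-prime (·₃-∣⇒∣ M {sq (rep {p} ∞)} p∤d root i3)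
    not-root (slope t) root = ∤1 p-prime (·₃-∣⇒∣ M {sq (rep (slope t))} p∤d root i1)

  primitive-image⇒∤entry : ∀ M → PrimitiveVec3 x → InImage M x → ∃₂ λ r s → ¬ p ∣ℤ M r s
  primitive-image⇒∤entry {x} M x-primitive (y , My≈x) = ∃-entry-∤ λ p∣M →
    ℕ.nonTrivial⇒≢1 {{prime⇒nonTrivial p-prime}}
      (x-primitive p λ i → ∣⇒∣ᵤ (subst (p ∣ℤ_) (My≈x i) (·-∣ˡ (p∣M i) y)))

  kernel-on-conic⇒sq : ∀ M {w} → p ∣ℤ₃ M ·₃ w → p ∣ℤ J w → ¬ p ∣ℤ₃ w → ∃ λ u → ¬ p ∣ℤ₂ u × p ∣ℤ₃ M ·₃ sq u
  kernel-on-conic⇒sq M {w} p∣Mw p∣Jw p∤w with p ∣ℤ? w i1 | p ∣ℤ? w i3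
  ... | no p∤w₁ | _ = vec2 (w i1) (w i2) , (λ p∣u → p∤w₁ (p∣u j1)) , λ i →
    subst (p ∣ℤ_) (sym (via-w₁ (M i i1) (M i i2) (M i i3) (w i1) (w i2) (w i3)))
      (∣m∣n⇒∣m-n (∣n⇒∣m*n (w i1) (p∣Mw i)) (∣n⇒∣m*n (M i i3) p∣Jw))
    where
    via-w₁ : ∀ a b c x y z → a * (x * x) + b * (x * y) + c * (y * y) ≡ x * (a * x + b * y + c * z) - c * (x * z - y * y)
    via-w₁ = solve-∀
  ... | yes _ | no p∤w₃ = vec2 (w i2) (w i3) , (λ p∣u → p∤w₃ (p∣u j2)) , λ i →
    subst (p ∣ℤ_) (sym (via-w₃ (M i i1) (M i i2) (M i i3) (w i1) (w i2) (w i3)))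
      (∣m∣n⇒∣m-n (∣n⇒∣m*n (w i3) (p∣Mw i)) (∣n⇒∣m*n (M i i1) p∣Jw))
    where
    via-w₃ : ∀ a b c x y z → a * (y * y) + b * (y * z) + c * (z * z) ≡ z * (a * x + b * y + c * z) - a * (x * z - y * y)
    via-w₃ = solve-∀
  ... | yes p∣w₁ | yes p∣w₃ = contradiction (λ { zero → p∣w₁ ; (suc zero) → p∣w₂ ; (suc (suc zero)) → p∣w₃ }) p∤w
    where
    square : ∀ x y z → x * z - (x * z - y * y) ≡ y * y
    square = solve-∀
    p∣w₂ : p ∣ℤ w i2
    p∣w₂ = ∣m*m⇒∣m p-prime (subst (p ∣ℤ_) (square (w i1) (w i2) (w i3)) (∣m∣n⇒∣m-n (∣m⇒∣m*n (w i3) p∣w₁) p∣Jw))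

-- Lattices

mat2 : ℤ → ℤ → ℤ → ℤ → Mat2
mat2 a b c d zero zero = a
mat2 a b c d zero (suc zero) = b
mat2 a b c d (suc zero) zero = c
mat2 a b c d (suc zero) (suc zero) = d

lattice : Point p → Mat2
lattice {p} ∞ = mat2 (+ p) (+ 0) (+ 0) (+ 1)
lattice {p} (slope t) = mat2 (+ 1) (+ 0) (+ toℕ t) (+ p)

lattice-det : (Q : Point p) → HasDet (lattice Q) p
lattice-det {p} ∞ = cong ∣_∣ (diagonal (+ p))
  where
  diagonal : ∀ P → P * + 1 - + 0 * + 0 ≡ P
  diagonal = solve-∀
lattice-det {p} (slope t) = cong ∣_∣ (triangular (+ p) (+ toℕ t))
  where
  triangular : ∀ P t → + 1 * P - + 0 * t ≡ P
  triangular = solve-∀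

∈lattice⇔OnLine : (Q : Point p) → u ∈Λ lattice Q ⇔ OnLine Q u
∈lattice⇔OnLine {p} {u} ∞ = mk⇔ to from
  where
  open ≡-Reasoning
  to : u ∈Λ lattice ∞ → OnLine ∞ u
  to (y , By≈u) = subst (λ c → p ∣ℤ + 0 * u j2 - + 1 * c) (By≈u j1) (divides (- y j1) (cross-∞ (+ p) (y j1) (y j2) (u j2)))
    where
    cross-∞ : ∀ P y₁ y₂ w → + 0 * w - + 1 * (P * y₁ + + 0 * y₂) ≡ - y₁ * P
    cross-∞ = solve-∀
  from : OnLine ∞ u → u ∈Λ lattice ∞
  from (divides k -u₁≡kp) = vec2 (- k) (u j2) , λ { zero → first ; (suc zero) → second (- k) (u j2) }
    where
    negate : ∀ P k w → P * - k + + 0 * w ≡ - (k * P)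
    negate = solve-∀
    undo : ∀ w x → - (+ 0 * w - + 1 * x) ≡ x
    undo = solve-∀
    first : + p * - k + + 0 * u j2 ≡ u j1
    first = begin
      + p * - k + + 0 * u j2       ≡⟨ negate (+ p) k (u j2) ⟩
      - (k * + p)                  ≡⟨ cong -_ -u₁≡kp ⟨
      - (+ 0 * u j2 - + 1 * u j1)  ≡⟨ undo (u j2) (u j1) ⟩
      u j1                         ∎
    second : ∀ y w → + 0 * y + + 1 * w ≡ w
    second = solve-∀
∈lattice⇔OnLine {p} {u} (slope t) = mk⇔ to from
  where
  open ≡-Reasoning
  to : u ∈Λ lattice (slope t) → OnLine (slope t) u
  to (y , By≈u) = subst₂ (λ c d → p ∣ℤ + 1 * d - + toℕ t * c) (By≈u j1) (By≈u j2)
    (divides (y j2) (cross-slope (+ p) (+ toℕ t) (y j1) (y j2)))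
    where
    cross-slope : ∀ P t y₁ y₂ → + 1 * (t * y₁ + P * y₂) - t * (+ 1 * y₁ + + 0 * y₂) ≡ y₂ * P
    cross-slope = solve-∀
  from : OnLine (slope t) u → u ∈Λ lattice (slope t)
  from (divides k u₂-tu₁≡kp) = vec2 (u j1) k , λ { zero → first (u j1) k ; (suc zero) → second }
    where
    first : ∀ x k → + 1 * x + + 0 * k ≡ x
    first = solve-∀
    swap : ∀ P k → P * k ≡ k * P
    swap = solve-∀
    restore : ∀ t x w → t * x + (+ 1 * w - t * x) ≡ w
    restore = solve-∀
    second : + toℕ t * u j1 + + p * k ≡ u j2
    second = begin
      + toℕ t * u j1 + + p * k                         ≡⟨ cong (_+_ (+ toℕ t * u j1)) (swap (+ p) k) ⟩
      + toℕ t * u j1 + k * + p                         ≡⟨ cong (_+_ (+ toℕ t * u j1)) u₂-tu₁≡kp ⟨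
      + toℕ t * u j1 + (+ 1 * u j2 - + toℕ t * u j1)   ≡⟨ restore (+ toℕ t) (u j1) (u j2) ⟩
      u j2                                             ∎

lattice-injective : Prime p → {Q Q′ : Point p} → SameLattice (lattice Q) (lattice Q′) → Q ≡ Q′
lattice-injective p-prime {Q} {Q′} same = sym (OnLine-rep⇒≡ p-prime Q′ Q
  (Equivalence.to (∈lattice⇔OnLine Q′) (Equivalence.to (same (rep Q)) (Equivalence.from (∈lattice⇔OnLine Q) (OnLine-rep Q)))))

-- Primes exactly dividing Δ

module _ (p-prime : Prime p) where

  private instance
    p≢0 : ℕ.NonZero p
    p≢0 = prime⇒nonZero p-prime

  exact-valuations : ∀ {Δ′ d D} → Δ′ * (d * d) ≡ D * D * D → d Signed.∣ Δ′ → p ∣ℤ Δ′ → ¬ p ℕ.* p ∣ℤ Δ′ →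
                     (∃ λ e → d ≡ e * + p × ¬ p ∣ℤ e) × (∃ λ E → D ≡ E * + p × ¬ p ∣ℤ E)
  exact-valuations {d = d} {D} rel d∣Δ′ (divides δ refl) p²∤Δ′ = (e , d≡ep , p∤e) , (E , D≡Ep , p∤E)
    where
    open ≡-Reasoning
    p∤δ : ¬ p ∣ℤ δ
    p∤δ p∣δ = p²∤Δ′ (*-pres-∣ℤ p∣δ ∣ℤ-refl)
    p∣D : p ∣ℤ D
    p∣D = [ ∣m*m⇒∣m p-prime , id ]′ (∣m*n⇒∣m⊎∣n p-prime (subst (p ∣ℤ_) rel (∣m⇒∣m*n (d * d) (∣n⇒∣m*n δ ∣ℤ-refl))))
    E : ℤ
    E = Signed.quotient p∣D
    D≡Ep : D ≡ E * + p
    D≡Ep = Signed._∣_.equality p∣D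
    reorder : ∀ δ d P → δ * (d * d) * P ≡ δ * P * (d * d)
    reorder = solve-∀
    expand : ∀ E P → E * P * (E * P) * (E * P) ≡ E * E * E * P * P * P
    expand = solve-∀
    δd²≡E³p² : δ * (d * d) ≡ E * E * E * + p * + p
    δd²≡E³p² = ℤₚ.*-cancelʳ-≡ (δ * (d * d)) (E * E * E * + p * + p) (+ p) (begin
      δ * (d * d) * + p                ≡⟨ reorder δ d (+ p) ⟩
      δ * + p * (d * d)                ≡⟨ rel ⟩
      D * D * D                        ≡⟨ cong (λ c → c * c * c) D≡Ep ⟩
      E * + p * (E * + p) * (E * + p)  ≡⟨ expand E (+ p) ⟩
      E * E * E * + p * + p * + p      ∎)
    p∣d : p ∣ℤ d
    p∣d = ∣m*m⇒∣m p-prime (∣m*n∧∤m⇒∣n p-prime (divides (E * E * E * + p) δd²≡E³p²) p∤δ)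
    e : ℤ
    e = Signed.quotient p∣d
    d≡ep : d ≡ e * + p
    d≡ep = Signed._∣_.equality p∣d
    squares : ∀ δ e P → δ * (e * P * (e * P)) ≡ δ * (e * e) * P * P
    squares = solve-∀
    δe²≡E³ : δ * (e * e) ≡ E * E * E
    δe²≡E³ = ℤₚ.*-cancelʳ-≡ (δ * (e * e)) (E * E * E) (+ p) (ℤₚ.*-cancelʳ-≡ (δ * (e * e) * + p) (E * E * E * + p) (+ p) (begin
      δ * (e * e) * + p * + p        ≡⟨ squares δ e (+ p) ⟨
      δ * (e * + p * (e * + p))      ≡⟨ cong (λ c → δ * (c * c)) d≡ep ⟨
      δ * (d * d)                    ≡⟨ δd²≡E³p² ⟩
      E * E * E * + p * + p          ∎))
    p∤e : ¬ p ∣ℤ e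
    p∤e p∣e = p²∤Δ′ (∣-trans (subst (p ℕ.* p ∣ℤ_) (sym d≡ep) (*-pres-∣ℤ p∣e ∣ℤ-refl)) d∣Δ′)
    p∤E : ¬ p ∣ℤ E
    p∤E p∣E = [ p∤δ , (λ p∣ee → p∤e (∣m*m⇒∣m p-prime p∣ee)) ]′
      (∣m*n⇒∣m⊎∣n p-prime (subst (p ∣ℤ_) (sym δe²≡E³) (∣m⇒∣m*n E (∣m⇒∣m*n E p∣E))))

  singular-kernel : ∀ M → p ∣ℤ det3 M → ¬ (∀ r s → p ∣ℤ adj M r s) → ∃ λ w → p ∣ℤ₃ M ·₃ w × ¬ p ∣ℤ₃ w
  singular-kernel M p∣d p∤adj = column (∃-entry-∤ {N = adj M} p∤adj)
    where
    column : (∃₂ λ r s → ¬ p ∣ℤ adj M r s) → ∃ λ w → p ∣ℤ₃ M ·₃ w × ¬ p ∣ℤ₃ w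
    column (r , s , p∤adjrs) = adj M ·₃ δ s , p∣M·column , p∤column
      where
      p∣M·column : p ∣ℤ₃ M ·₃ (adj M ·₃ δ s)
      p∣M·column i = subst (p ∣ℤ_) (sym (·₃-adj M (δ s) i)) (∣m⇒∣m*n (δ s i) p∣d)
      p∤column : ¬ p ∣ℤ₃ adj M ·₃ δ s
      p∤column p∣column = p∤adjrs (subst (p ∣ℤ_) (·₃-δ (adj M) r s) (p∣column r))

  p³∣[ep]²⇒p∣e : ∀ {e} → p ℕ.* (p ℕ.* p) ∣ℤ e * + p * (e * + p) → p ∣ℤ e
  p³∣[ep]²⇒p∣e {e} (divides k e²p²≡kp³) =
    ∣m*m⇒∣m p-prime (divides k (ℤₚ.*-cancelʳ-≡ (e * e) (k * + p) (+ p) (ℤₚ.*-cancelʳ-≡ (e * e * + p) (k * + p * + p) (+ p) (begin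
      e * e * + p * + p             ≡⟨ expand e (+ p) ⟩
      e * + p * (e * + p)           ≡⟨ e²p²≡kp³ ⟩
      k * + (p ℕ.* (p ℕ.* p))       ≡⟨ cong (k *_) (trans (ℤₚ.pos-* p (p ℕ.* p)) (cong (+ p *_) (ℤₚ.pos-* p p))) ⟩
      k * (+ p * (+ p * + p))       ≡⟨ reassociate k (+ p) ⟩
      k * + p * + p * + p           ∎))))
    where
    open ≡-Reasoning
    expand : ∀ e P → e * e * P * P ≡ e * P * (e * P)
    expand = solve-∀
    reassociate : ∀ k P → k * (P * (P * P)) ≡ k * P * P * P
    reassociate = solve-∀

  module _ {q : QF} {M : Mat3} {D : ℤ} (transform : ∀ x → eval q (M ·₃ x) ≡ D * J x)
           {E : ℤ} (D≡Ep : D ≡ E * + p) (p∤E : ¬ p ∣ℤ E) {e : ℤ} (d≡ep : det3 M ≡ e * + p) (p∤e : ¬ p ∣ℤ e) where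

    -- D J(w) = q(M w) is divisible by p², while p ∥ D.
    kernel⇒J : p ∣ℤ₃ M ·₃ w → p ∣ℤ J w
    kernel⇒J {w} p∣Mw = ∣m*n∧∤m⇒∣n p-prime (Signed.*-cancelʳ-∣ (+ p) (subst₂ Signed._∣_ (ℤₚ.pos-* p p) q[Mw]≡ (eval-∣ q p∣Mw))) p∤E
      where
      open ≡-Reasoning
      swap : ∀ E P x → E * P * x ≡ E * x * P
      swap = solve-∀
      q[Mw]≡ : eval q (M ·₃ w) ≡ E * J w * + p
      q[Mw]≡ = begin
        eval q (M ·₃ w)   ≡⟨ transform w ⟩
        D * J w           ≡⟨ cong (_* J w) D≡Ep ⟩
        E * + p * J w     ≡⟨ swap E (+ p) (J w) ⟩
        E * J w * + p     ∎

    J-polar-∣ : p ∣ℤ₃ M ·₃ v → p ∣ℤ₃ M ·₃ w → p ∣ℤ J (λ i → v i + w i) - J v - J w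
    J-polar-∣ {v} {w} p∣Mv p∣Mw = ∣m∣n⇒∣m-n (∣m∣n⇒∣m-n (kernel⇒J {w = λ i → v i + w i} p∣M[v+w]) (kernel⇒J {w = v} p∣Mv)) (kernel⇒J {w = w} p∣Mw)
      where
      p∣M[v+w] : p ∣ℤ₃ M ·₃ (λ i → v i + w i)
      p∣M[v+w] i = subst (p ∣ℤ_) (sym (·₃-+ M v w i)) (∣m∣n⇒∣m+n (p∣Mv i) (p∣Mw i))

    -- The polar form of J at (r², s²) is the square of cross r s.
    roots-coincide : {Q Q′ : Point p} → IsRoot M Q → IsRoot M Q′ → Q ≡ Q′
    roots-coincide {Q} {Q′} root root′ = OnLine-rep⇒≡ p-prime Q Q′ (∣m*m⇒∣m p-prime
      (subst (p ∣ℤ_) (polar-sq (rep Q j1) (rep Q j2) (rep Q′ j1) (rep Q′ j2)) (J-polar-∣ {sq (rep Q)} {sq (rep Q′)} root root′)))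
      where
      polar-sq : ∀ a b c d →
                 (a * a + c * c) * (b * b + d * d) - (a * b + c * d) * (a * b + c * d)
                   - (a * a * (b * b) - a * b * (a * b)) - (c * c * (d * d) - c * d * (c * d))
                 ≡ (a * d - b * c) * (a * d - b * c)
      polar-sq = solve-∀

    -- Otherwise p³ ∣ det (adj M) = d², contradicting p ∥ d.
    adj-∤ : ¬ (∀ r s → p ∣ℤ adj M r s)
    adj-∤ p∣adj = p∤e (p³∣[ep]²⇒p∣e (subst (λ d → p ℕ.* (p ℕ.* p) ∣ℤ d * d) d≡ep (subst (p ℕ.* (p ℕ.* p) ∣ℤ_) (det3-adj M) (det3-∣ p∣adj))))

    root-exists : ∃ λ (Q : Point p) → IsRoot M Q
    root-exists = on-conic (singular-kernel M (divides e d≡ep) adj-∤)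
      where
      from-sq : (∃ λ u → ¬ p ∣ℤ₂ u × p ∣ℤ₃ M ·₃ sq u) → ∃ λ (Q : Point p) → IsRoot M Q
      from-sq (u , p∤u , p∣Mu²) = ∃-root p-prime M p∤u p∣Mu²
      on-conic : (∃ λ w → p ∣ℤ₃ M ·₃ w × ¬ p ∣ℤ₃ w) → ∃ λ (Q : Point p) → IsRoot M Q
      on-conic (w , p∣Mw , p∤w) = from-sq (kernel-on-conic⇒sq p-prime M p∣Mw (kernel⇒J {w = w} p∣Mw) p∤w)

    one-root : length (roots M p) ≡ 1
    one-root = all-equal⇒length≡1 {x = proj₁ root-exists} (roots-unique M) (Equivalence.from (∈-roots⇔ M) (proj₂ root-exists))
      (λ Q∈ Q′∈ → roots-coincide (Equivalence.to (∈-roots⇔ M) Q∈) (Equivalence.to (∈-roots⇔ M) Q′∈))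

  exactly-one-root : {q : QF} {M : Mat3} {D : ℤ} → (∀ x → eval q (M ·₃ x) ≡ D * J x) →
                     Δ q * (det3 M * det3 M) ≡ D * D * D → det3 M Signed.∣ Δ q → p ∣ℤ Δ q → ¬ p ℕ.* p ∣ℤ Δ q →
                     length (roots M p) ≡ 1
  exactly-one-root {q} {M} {D} transform det-relation det∣Δ p∣Δ p²∤Δ
    with exact-valuations det-relation det∣Δ p∣Δ p²∤Δ
  ... | (e , d≡ep , p∤e) , (E , D≡Ep , p∤E) = one-root {q} {M} {D} transform {E} D≡Ep p∤E {e} d≡ep p∤e

-- The partition of the primes

𝒫 : Mat3 → Fin 3 → ℕ → Set
𝒫 M n p = Prime p × length (roots M p) ≡ toℕ n

LatticeFamily : Mat3 → ℕ → ℕ → Set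
LatticeFamily M p n =
  ∃ λ (Λ : Fin n → Mat2) →
    ((i : Fin n) → HasDet (Λ i) p)
    × ((i j : Fin n) → ¬ (i ≡ j) → ¬ SameLattice (Λ i) (Λ j))
    × ((u : Vec2) → (p ∣₃ (M ·₃ sq u)) ⇔ (∃ λ i → u ∈Λ Λ i))

root-lattices : Prime p → ∀ M → Fin (length (roots M p)) → LatticeFamily M p (length (roots M p))
root-lattices {p} p-prime M i₀ = Λ , (λ i → lattice-det (lookup (roots M p) i)) , distinct , ∣⇔∈Λ
  where
  Λ : Fin (length (roots M p)) → Mat2
  Λ i = lattice (lookup (roots M p) i)
  distinct : ∀ i j → i ≢ j → ¬ SameLattice (Λ i) (Λ j)
  distinct i j i≢j same = i≢j (lookup-injective (roots-unique M) (lattice-injective p-prime same))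
  ∣⇔∈Λ : ∀ u → (p ∣₃ (M ·₃ sq u)) ⇔ (∃ λ i → u ∈Λ Λ i)
  ∣⇔∈Λ u = mk⇔ to from
    where
    on-root-line : p ∣ℤ₂ u ⊎ ∃ (λ (Q : Point p) → IsRoot M Q × OnLine Q u) → ∃ λ i → u ∈Λ Λ i
    on-root-line (inj₁ p∣u) = i₀ , Equivalence.from (∈lattice⇔OnLine (lookup (roots M p) i₀)) (∣ℤ₂⇒OnLine {u = u} p∣u (lookup (roots M p) i₀))
    on-root-line (inj₂ (Q , root , on)) = Any.index Q∈ , subst (λ Q → u ∈Λ lattice Q) (lookup-index Q∈) (Equivalence.from (∈lattice⇔OnLine Q) on)
      where
      Q∈ : Q ∈ roots M p
      Q∈ = Equivalence.from (∈-roots⇔ M) root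
    to : p ∣₃ (M ·₃ sq u) → ∃ λ i → u ∈Λ Λ i
    to p∣Mu² = on-root-line (Equivalence.to (·₃sq-∣⇔ p-prime M u) (Equivalence.to ∣₃⇔∣ℤ₃ p∣Mu²))
    from : (∃ λ i → u ∈Λ Λ i) → p ∣₃ (M ·₃ sq u)
    from (i , u∈Λᵢ) = Equivalence.from ∣₃⇔∣ℤ₃ (Equivalence.from (·₃sq-∣⇔ p-prime M u)
      (inj₂ (lookup (roots M p) i , Equivalence.to (∈-roots⇔ M) (∈-lookup i) , Equivalence.to (∈lattice⇔OnLine {u = u} (lookup (roots M p) i)) u∈Λᵢ)))

𝒫-lattices : ∀ M (n : Fin 3) → ¬ (n ≡ zero) → 𝒫 M n p → LatticeFamily M p (toℕ n)
𝒫-lattices M zero n≢0 _ = contradiction refl n≢0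
𝒫-lattices M (suc n) _ (p-prime , len) = subst (LatticeFamily M _) len (root-lattices p-prime M (cast (sym len) zero))

𝒫₀⇔ : ∀ M → 𝒫 M zero p → (u : Vec2) → (p ∣₃ (M ·₃ sq u)) ⇔ (p ∣₂ u)
𝒫₀⇔ {p} M (p-prime , no-root) u = mk⇔ to (λ p∣u → Equivalence.from ∣₃⇔∣ℤ₃ (Equivalence.from (·₃sq-∣⇔ p-prime M u) (inj₁ (Equivalence.to ∣₂⇔∣ℤ₂ p∣u))))
  where
  to : p ∣₃ (M ·₃ sq u) → p ∣₂ u
  to p∣Mu² with Equivalence.to (·₃sq-∣⇔ p-prime M u) (Equivalence.to ∣₃⇔∣ℤ₃ p∣Mu²)
  ... | inj₁ p∣u = Equivalence.from ∣₂⇔∣ℤ₂ p∣u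
  ... | inj₂ (Q , root , _) = contradiction (Equivalence.from (∈-roots⇔ M {Q}) root) (length≡0⇒∉ no-root)

𝒫-covers : ∀ M → PrimitiveVec3 x → InImage M x → (p : ℕ) → Prime p → ∃ λ n → 𝒫 M n p
𝒫-covers M x-primitive x∈M p p-prime with primitive-image⇒∤entry p-prime M x-primitive x∈M
... | _ , _ , p∤Mrs = fromℕ< (ℕ.s≤s (length-roots≤2 p-prime M p∤Mrs)) , p-prime , sym (Finₚ.toℕ-fromℕ< _)

𝒫-disjoint : ∀ M (p : ℕ) (n m : Fin 3) → 𝒫 M n p → 𝒫 M m p → n ≡ m
𝒫-disjoint M p n m (_ , len≡n) (_ , len≡m) = Finₚ.toℕ-injective (trans (sym len≡n) len≡m)

lemma5 : (q : QF) → PrimitiveQF q → Isotropic q → + 0 < Δ q →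
           (K : ℕ) (M : Fin K → Mat3) (D : Fin K → ℤ) → Admissible q K M D →
           (k : Fin K) → CNonempty q (M k) →
           ∃ λ (𝒫 : Fin 3 → ℕ → Set) →
             ((n : Fin 3) (p : ℕ) → 𝒫 n p → Prime p)
             × ((p : ℕ) → Prime p → ∃ λ n → 𝒫 n p)
             × ((p : ℕ) (n m : Fin 3) → 𝒫 n p → 𝒫 m p → n ≡ m)
             × ((p : ℕ) → Prime p → ¬ ((+ p) ∣ Δ q) → 𝒫 zero p)
             × ((p : ℕ) → 𝒫 zero p → (u : Vec2) → (p ∣₃ (M k ·₃ sq u)) ⇔ (p ∣₂ u))
             × ((p : ℕ) (n : Fin 3) → ¬ (n ≡ zero) → 𝒫 n p →
                  ∃ λ (Λ : Fin (toℕ n) → Mat2) →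
                    ((i : Fin (toℕ n)) → HasDet (Λ i) p)
                    × ((i j : Fin (toℕ n)) → ¬ (i ≡ j) → ¬ SameLattice (Λ i) (Λ j))
                    × ((u : Vec2) → (p ∣₃ (M k ·₃ sq u)) ⇔ (∃ λ i → u ∈Λ Λ i)))
             × ((p : ℕ) → Prime p → ExactlyDivides p (Δ q) → 𝒫 (suc zero) p)
lemma5 q _ _ _ _ M D adm k (x , x-primitive , x∈M , _) =
  𝒫 (M k) , (λ _ _ → proj₁) , 𝒫-covers (M k) x-primitive x∈M , 𝒫-disjoint (M k) ,
  (λ p p-prime p∤Δ → p-prime , no-roots p-prime (M k) (λ p∣d → p∤Δ (∣⇒∣ᵤ (∣-trans p∣d det∣Δ)))) ,
  (λ _ → 𝒫₀⇔ (M k)) ,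
  (λ _ → 𝒫-lattices (M k)) ,
  (λ p p-prime (p∣Δ , p²∤Δ) → p-prime ,
     exactly-one-root p-prime {q} {M k} {D k} (transform k) (detRel k) det∣Δ (∣ᵤ⇒∣ p∣Δ) (λ p²∣Δ → p²∤Δ (∣⇒∣ᵤ p²∣Δ)))
  where
  open Admissible adm hiding (det∣Δ)
  det∣Δ : det3 (M k) Signed.∣ Δ q
  det∣Δ = ∣ᵤ⇒∣ (Admissible.det∣Δ adm k)
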